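{- Let $\rho: l\to r\Leftarrow s_1\twoheadrightarrow t_1;\dots;s_k\twoheadrightarrow t_k$ be an extended deterministic conditional rewrite rule, and for $1\le i\le k$ let $X_i=\mathrm{Var}(l,t_1,\dots,t_{i-1})$ and $Y_i=\mathrm{Var}(r,t_i,s_{i+1},t_{i+1},\dots,s_k,t_k)$. Then: (1) $\rho$ is $\mathbb{U}_{\mathrm{opt}}$-LL iff all of $l,t_1,\dots,t_k$ are linear and $\mathrm{Var}(t_i)\cap X_i=\emptyset$ for all $1\le i\le k$; (2) $\rho$ is $\mathbb{U}_{\mathrm{opt}}$-RL iff all of $r,s_1,\dots,s_k$ are linear and $\mathrm{Var}(s_i)\cap Y_i=\emptyset$ for all $1\le i\le k$; (3) $\rho$ is $\mathbb{U}_{\mathrm{opt}}$-NE iff $\mathrm{Var}(l)\subseteq\mathrm{Var}(r,s_1,\dots,s_k)$ and $\mathrm{Var}(t_i)\subseteq\mathrm{Var}(r,s_{i+1},\dots,s_k)$ for all $1\le i\le k$.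
   Context: $\mathrm{Var}(t_1,\dots,t_n)$ is the set of variables occurring in the terms; a term is linear if no variable occurs in it twice. An extended conditional rewrite rule $l\to r\Leftarrow s_1\twoheadrightarrow t_1;\dots;s_k\twoheadrightarrow t_k$ ($k\ge0$; $l$ may be a variable) is deterministic if $\mathrm{Var}(s_i)\subseteq\mathrm{Var}(l,t_1,\dots,t_{i-1})$ for all $i$. An unconditional rule $l\to r$ is LL if $l$ is linear, RL if $r$ is linear, NE if $\mathrm{Var}(l)\subseteq\mathrm{Var}(r)$. Optimized unraveling of $\rho$ with $k\ge1$: with $Z_i=X_i\cap Y_i$, $\overrightarrow{X}$ the list of the elements of a finite variable set $X$ in a fixed order (without repetition), and fresh function symbols $U^\rho_1,\dots,U^\rho_k$: $\mathbb{U}_{\mathrm{opt}}(\rho)=\{l\to U^\rho_1(s_1,\overrightarrow{Z_1})\}\cup\{U^\rho_i(t_i,\overrightarrow{Z_i})\to U^\rho_{i+1}(s_{i+1},\overrightarrow{Z_{i+1}})\mid 1\le i<k\}\cup\{U^\rho_k(t_k,\overrightarrow{Z_k})\to r\}$; for $k=0$, $\mathbb{U}_{\mathrm{opt}}(\rho)=\{l\to r\}$. For a property P of unconditional rules, $\rho$ is $\mathbb{U}_{\mathrm{opt}}$-P if every rule in $\mathbb{U}_{\mathrm{opt}}(\rho)$ has P. -}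

module Defs where

open import Data.Nat using (ℕ; zero; suc)
open import Data.Fin using (Fin; toℕ)
open import Data.Sum using (_⊎_; inj₁; inj₂)
open import Data.Product using (_×_; _,_; proj₁; proj₂)
open import Data.List using (List; []; _∷_; _++_; take; drop; filter; deduplicate; length; lookup; concatMap)
open import Data.List.Relation.Unary.All using (All)
open import Data.List.Relation.Unary.Unique.Propositional using (Unique)
open import Data.List.Relation.Binary.Subset.Propositional using (_⊆_)
open import Data.List.Membership.DecPropositional using () renaming (_∈?_ to dec∈)
open import Relation.Binary.Definitions using (DecidableEquality)

data Term (F V : Set) : Set where
  var : V → Term F V
  fun : F → List (Term F V) → Term F V

-- Var(t) as the list of variable OCCURRENCES, left to right (with repetitions).
mutual
  vars : {F V : Set} → Term F V → List V
  vars (var x)    = x ∷ []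
  vars (fun f ts) = varsL ts

  varsL : {F V : Set} → List (Term F V) → List V
  varsL []       = []
  varsL (t ∷ ts) = vars t ++ varsL ts

-- Embedding of terms into the extended signature F ⊎ ℕ; inj₂ i is the fresh U^ρ_(i+1).
mutual
  lift : {F V : Set} → Term F V → Term (F ⊎ ℕ) V
  lift (var x)    = var x
  lift (fun f ts) = fun (inj₁ f) (liftL ts)

  liftL : {F V : Set} → List (Term F V) → List (Term (F ⊎ ℕ) V)
  liftL []       = []
  liftL (t ∷ ts) = lift t ∷ liftL ts

Rule : Set → Set → Set
Rule F V = Term F V × Term F V

-- Extended conditional rewrite rule  l → r ⇐ s₁ ↠ t₁; …; s_k ↠ t_k
-- (l may be a variable; no variable conditions on r).
record CRule (F V : Set) : Set where
  constructor crule
  field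
    lhs  : Term F V
    rhs  : Term F V
    conds : List (Term F V × Term F V)

open CRule public

LL : {F V : Set} → Rule F V → Set
LL (l , r) = Unique (vars l)

RL : {F V : Set} → Rule F V → Set
RL (l , r) = Unique (vars r)

NE : {F V : Set} → Rule F V → Set
NE (l , r) = vars l ⊆ vars r

Linear : {F V : Set} → Term F V → Set
Linear t = Unique (vars t)

module _ {F V : Set} (ρ : CRule F V) where
  K : ℕ
  K = length (conds ρ)

  -- conditions indexed by Fin k (0-based: index i stands for condition i+1 of the paper)
  s : Fin K → Term F V
  s i = proj₁ (lookup (conds ρ) i)

  t : Fin K → Term F V
  t i = proj₂ (lookup (conds ρ) i)

  varsBoth : List (Term F V × Term F V) → List V
  varsBoth = concatMap (λ c → vars (proj₁ c) ++ vars (proj₂ c))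

  Xℕ : ℕ → List V
  Xℕ i = vars (lhs ρ) ++ concatMap (λ c → vars (proj₂ c)) (take i (conds ρ))

  Yℕ : ℕ → List V
  Yℕ i with drop i (conds ρ)
  ... | []             = vars (rhs ρ)
  ... | (_ , ti) ∷ rest = vars (rhs ρ) ++ vars ti ++ varsBoth rest

  X : Fin K → List V
  X i = Xℕ (toℕ i)

  Y : Fin K → List V
  Y i = Yℕ (toℕ i)

  RS : Fin K → List V
  RS i = vars (rhs ρ) ++ concatMap (λ c → vars (proj₁ c)) (drop (suc (toℕ i)) (conds ρ))

  RSall : List V
  RSall = vars (rhs ρ) ++ concatMap (λ c → vars (proj₁ c)) (conds ρ)

  Deterministic : Set
  Deterministic = ∀ (i : Fin K) → vars (s i) ⊆ X i

  module _ (_≟_ : DecidableEquality V) where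
    Zℕ : ℕ → List V
    Zℕ i = deduplicate _≟_ (filter (λ x → dec∈ _≟_ x (Yℕ i)) (Xℕ i))

    U : ℕ → Term F V → Term (F ⊎ ℕ) V
    U i a = fun (inj₂ i) (lift a ∷ Data.List.map var (Zℕ i))

    chain : ℕ → Term (F ⊎ ℕ) V → List (Term F V × Term F V) → List (Rule (F ⊎ ℕ) V)
    chain i l′ []              = (l′ , lift (rhs ρ)) ∷ []
    chain i l′ ((si , ti) ∷ cs) = (l′ , U i si) ∷ chain (suc i) (U i ti) cs

    Uopt : List (Rule (F ⊎ ℕ) V)
    Uopt = chain 0 (lift (lhs ρ)) (conds ρ)

    Uopt-P : (Rule (F ⊎ ℕ) V → Set) → Set
    Uopt-P P = All P Uopt

module Submission where

-- The unraveling is the chain  l → U₁(s₁,Z₁),  Uᵢ(tᵢ,Zᵢ) → Uᵢ₊₁(sᵢ₊₁,Zᵢ₊₁), …,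
-- U_k(t_k,Z_k) → r, and the whole proof rests on three observations:
--   * Var(Uᵢ(a,Zᵢ)) = Var(a) ++ Zᵢ, where Zᵢ is duplicate-free and x ∈ Zᵢ ⇔ x ∈ Xᵢ ∩ Yᵢ;
--   * LL only looks at left-hand sides and RL only at right-hand sides, so
--     𝕌_opt is LL (RL) iff l (r) and every Uᵢ(tᵢ,Zᵢ) (Uᵢ(sᵢ,Zᵢ)) is linear;
--     since Var(tᵢ) ⊆ Yᵢ always and Var(sᵢ) ⊆ Xᵢ by determinism, "disjoint
--     from Zᵢ" becomes "disjoint from Xᵢ" resp. "disjoint from Yᵢ";
--   * NE is proved by walking along the chain: soundness needs nothing, while
--     completeness carries the invariant that the current left-hand side has
--     its variables in Xᵢ and in Var(r, sᵢ, …, s_k).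

open import Defs
open import Data.Nat using (ℕ; zero; suc; _+_)
open import Data.Nat.Properties using (+-identityʳ; +-suc)
open import Data.Fin using (Fin; toℕ) renaming (zero to fzero; suc to fsuc)
open import Data.Fin.Properties using (∀-cons)
open import Data.Product using (_×_; _,_; proj₁; proj₂)
open import Data.Sum using (_⊎_; inj₁; inj₂; [_,_]′)
open import Data.List using (List; []; _∷_; _++_; take; drop; lookup; length; concatMap; map)
open import Data.List.Properties using (++-identityʳ; ++-assoc)
open import Data.List.Relation.Unary.All as All using (All; []; _∷_)
import Data.List.Relation.Unary.All.Properties as AllProps
open import Data.List.Relation.Unary.AllPairs using ([]; _∷_)
open import Data.List.Relation.Unary.Any using (here; there)
open import Data.List.Relation.Unary.Unique.Propositional using (Unique)
import Data.List.Relation.Unary.Unique.Propositional.Properties as Unique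
open import Data.List.Relation.Unary.Unique.DecPropositional.Properties using (deduplicate-!)
open import Data.List.Membership.Propositional using (_∈_)
open import Data.List.Membership.Propositional.Properties
  using (∈-++⁺ˡ; ∈-++⁺ʳ; ∈-++⁻; ∈-filter⁺; ∈-filter⁻; ∈-deduplicate⁺; ∈-deduplicate⁻)
open import Data.List.Membership.DecPropositional using () renaming (_∈?_ to dec∈)
open import Data.List.Relation.Binary.Subset.Propositional using (_⊆_)
open import Data.List.Relation.Binary.Subset.Propositional.Properties
  using (⊆-trans; xs⊆xs++ys; xs⊆ys++xs; ++⁺; ++⁺ʳ)
open import Data.List.Relation.Binary.Disjoint.Propositional using (Disjoint)
open import Relation.Binary.Definitions using (DecidableEquality)
open import Relation.Binary.PropositionalEquality using (_≡_; refl; sym; trans; cong; cong₂; subst)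
open import Function.Bundles using (_⇔_; mk⇔; Equivalence)
open Equivalence using (to; from)
open import Function.Construct.Identity using (⇔-id)
open import Function.Construct.Composition using (_⇔-∘_)
open import Data.Product.Function.NonDependent.Propositional using (_×-⇔_)

unique-++⁻ : {A : Set} (xs : List A) {ys : List A} →
             Unique (xs ++ ys) → Unique xs × Unique ys × Disjoint xs ys
unique-++⁻ []       u       = [] , u , λ { (() , _) }
unique-++⁻ (x ∷ xs) {ys} (x∉ ∷ u) with unique-++⁻ xs u
... | uxs , uys , xs#ys = AllProps.++⁻ˡ xs x∉ ∷ uxs , uys , disjoint
  where
  disjoint : Disjoint (x ∷ xs) ys
  disjoint (here refl , v∈ys) = All.lookup (AllProps.++⁻ʳ xs x∉) v∈ys refl
  disjoint (there v∈xs , v∈ys) = xs#ys (v∈xs , v∈ys)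

++-⊆⇔ : {A : Set} {xs ys zs : List A} → (xs ++ ys ⊆ zs) ⇔ (xs ⊆ zs × ys ⊆ zs)
++-⊆⇔ {A} {xs} {ys} {zs} = mk⇔ split join
  where
  split : xs ++ ys ⊆ zs → xs ⊆ zs × ys ⊆ zs
  split h = (λ x∈ → h (∈-++⁺ˡ x∈)) , (λ x∈ → h (∈-++⁺ʳ xs x∈))
  join : xs ⊆ zs × ys ⊆ zs → xs ++ ys ⊆ zs
  join (p , q) x∈ = [ p , q ]′ (∈-++⁻ xs x∈)

∀-⇔ : {I : Set} {P Q : I → Set} → (∀ i → P i ⇔ Q i) → (∀ i → P i) ⇔ (∀ i → Q i)
∀-⇔ P⇔Q = mk⇔ (λ p i → to (P⇔Q i) (p i)) (λ q i → from (P⇔Q i) (q i))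

∀-×-⇔ : {I : Set} {P Q : I → Set} → (∀ i → P i × Q i) ⇔ ((∀ i → P i) × (∀ i → Q i))
∀-×-⇔ = mk⇔ (λ pq → (λ i → proj₁ (pq i)) , (λ i → proj₂ (pq i))) (λ (p , q) i → p i , q i)

drop-lookup : {A : Set} (xs : List A) (j : Fin (length xs)) →
              drop (toℕ j) xs ≡ lookup xs j ∷ drop (suc (toℕ j)) xs
drop-lookup (x ∷ xs) fzero    = refl
drop-lookup (x ∷ xs) (fsuc j) = drop-lookup xs j

drop-suc : {A : Set} (n : ℕ) (xs : List A) {y : A} {ys : List A} →
           drop n xs ≡ y ∷ ys → drop (suc n) xs ≡ ys
drop-suc zero    (x ∷ xs) refl = refl
drop-suc (suc n) (x ∷ xs) eq   = drop-suc n xs eq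

concatMap-take-suc : {A B : Set} (f : A → List B) (n : ℕ) (xs : List A) {y : A} {ys : List A} →
                     drop n xs ≡ y ∷ ys → concatMap f (take (suc n) xs) ≡ concatMap f (take n xs) ++ f y
concatMap-take-suc f zero    (x ∷ xs) refl = ++-identityʳ (f x)
concatMap-take-suc f (suc n) (x ∷ xs) {y} eq =
  trans (cong (f x ++_) (concatMap-take-suc f n xs eq)) (sym (++-assoc (f x) _ (f y)))

shift-∀ : {m : ℕ} (P : ℕ → Fin (suc m) → Set) (n : ℕ) →
          (P n fzero × (∀ j → P (suc n + toℕ j) (fsuc j))) ⇔ (∀ j → P (n + toℕ j) j)
shift-∀ P n = mk⇔
  (λ (h , hs) → ∀-cons {P = λ j → P (n + toℕ j) j}
                  (subst (λ k → P k fzero) (sym (+-identityʳ n)) h)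
                  (λ j → subst (λ k → P k (fsuc j)) (sym (+-suc n (toℕ j))) (hs j)))
  (λ h → subst (λ k → P k fzero) (+-identityʳ n) (h fzero)
       , λ j → subst (λ k → P k (fsuc j)) (+-suc n (toℕ j)) (h (fsuc j)))

mutual
  vars-lift : {F V : Set} (a : Term F V) → vars (lift a) ≡ vars a
  vars-lift (var x)    = refl
  vars-lift (fun f ts) = varsL-liftL ts

  varsL-liftL : {F V : Set} (ts : List (Term F V)) → varsL (liftL ts) ≡ varsL ts
  varsL-liftL []       = refl
  varsL-liftL (t ∷ ts) = cong₂ _++_ (vars-lift t) (varsL-liftL ts)

linear-lift : {F V : Set} (a : Term F V) → Linear (lift a) ⇔ Linear a
linear-lift a = mk⇔ (subst Unique (vars-lift a)) (subst Unique (sym (vars-lift a)))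

varsL-map-var : {F V : Set} (zs : List V) → varsL {F} (map var zs) ≡ zs
varsL-map-var []       = refl
varsL-map-var (z ∷ zs) = cong (z ∷_) (varsL-map-var zs)

module Unraveling {F V : Set} (_≟_ : DecidableEquality V) (ρ : CRule F V) where

  Cond : Set
  Cond = Term F V × Term F V

  cs : List Cond
  cs = conds ρ

  -- Z i is the list Z⃗ᵢ₊₁ passed along by the fresh symbol U_{i+1}.
  Z : ℕ → List V
  Z = Zℕ ρ _≟_

  Ũ : ℕ → Term F V → Term (F ⊎ ℕ) V
  Ũ = U ρ _≟_

  vars-U : ∀ i a → vars (Ũ i a) ≡ vars a ++ Z i
  vars-U i a = cong₂ _++_ (vars-lift a) (varsL-map-var (Z i))

  ∈Z⇔ : ∀ {i x} → x ∈ Z i ⇔ (x ∈ Xℕ ρ i × x ∈ Yℕ ρ i)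
  ∈Z⇔ {i} = mk⇔
    (λ x∈ → ∈-filter⁻ (λ y → dec∈ _≟_ y (Yℕ ρ i)) (∈-deduplicate⁻ _≟_ _ x∈))
    (λ (x∈X , x∈Y) → ∈-deduplicate⁺ _≟_ (∈-filter⁺ (λ y → dec∈ _≟_ y (Yℕ ρ i)) x∈X x∈Y))

  Z-unique : ∀ i → Unique (Z i)
  Z-unique i = deduplicate-! _≟_ _

  X-step : ∀ n {c ds} → drop n cs ≡ c ∷ ds → Xℕ ρ (suc n) ≡ Xℕ ρ n ++ vars (proj₂ c)
  X-step n eq = trans (cong (vars (lhs ρ) ++_) (concatMap-take-suc (λ c → vars (proj₂ c)) n cs eq))
                      (sym (++-assoc (vars (lhs ρ)) _ _))

  Y-step : ∀ n {s t ds} → drop n cs ≡ (s , t) ∷ ds → Yℕ ρ n ≡ vars (rhs ρ) ++ vars t ++ varsBoth ρ ds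
  Y-step n eq rewrite eq = refl

  -- Var(tᵢ) ⊆ Yᵢ holds for every rule; this is why X appears in the LL criterion.
  t⊆Y : ∀ i → vars (t ρ i) ⊆ Y ρ i
  t⊆Y i x∈ = subst (_ ∈_) (sym (Y-step (toℕ i) (drop-lookup cs i))) (∈-++⁺ʳ (vars (rhs ρ)) (∈-++⁺ˡ x∈))

  linear-U : ∀ i a → Linear (Ũ i a) ⇔ (Linear a × Disjoint (vars a) (Z i))
  linear-U i a = mk⇔ split join
    where
    split : Linear (Ũ i a) → Linear a × Disjoint (vars a) (Z i)
    split u with unique-++⁻ (vars a) (subst Unique (vars-U i a) u)
    ... | ua , _ , a#Z = ua , a#Z
    join : Linear a × Disjoint (vars a) (Z i) → Linear (Ũ i a)
    join (ua , a#Z) = subst Unique (sym (vars-U i a)) (Unique.++⁺ ua (Z-unique i) a#Z)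

  disjoint-Z⇔X : ∀ {i} (xs : List V) → xs ⊆ Yℕ ρ i → Disjoint xs (Z i) ⇔ Disjoint xs (Xℕ ρ i)
  disjoint-Z⇔X {i} xs xs⊆Y = mk⇔
    (λ xs#Z {_} (x∈xs , x∈X) → xs#Z (x∈xs , from (∈Z⇔ {i}) (x∈X , xs⊆Y x∈xs)))
    (λ xs#X {_} (x∈xs , x∈Z) → xs#X (x∈xs , proj₁ (to (∈Z⇔ {i}) x∈Z)))

  disjoint-Z⇔Y : ∀ {i} (xs : List V) → xs ⊆ Xℕ ρ i → Disjoint xs (Z i) ⇔ Disjoint xs (Yℕ ρ i)
  disjoint-Z⇔Y {i} xs xs⊆X = mk⇔
    (λ xs#Z {_} (x∈xs , x∈Y) → xs#Z (x∈xs , from (∈Z⇔ {i}) (xs⊆X x∈xs , x∈Y)))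
    (λ xs#Y {_} (x∈xs , x∈Z) → xs#Y (x∈xs , proj₂ (to (∈Z⇔ {i}) x∈Z)))

  chain-lhs : (Q : Term (F ⊎ ℕ) V → Set) (n : ℕ) (l′ : Term (F ⊎ ℕ) V) (ds : List Cond) →
              All (λ rule → Q (proj₁ rule)) (chain ρ _≟_ n l′ ds)
                ⇔ (Q l′ × ∀ j → Q (Ũ (n + toℕ j) (proj₂ (lookup ds j))))
  chain-lhs Q n l′ [] = mk⇔ (λ { (q ∷ []) → q , λ () }) (λ (q , _) → q ∷ [])
  chain-lhs Q n l′ ((s , t) ∷ ds) = mk⇔
    (λ { (q ∷ qs) → q , to shift (to rest qs) })
    (λ (q , qs) → q ∷ from rest (from shift qs))
    where
    rest : All (λ rule → Q (proj₁ rule)) (chain ρ _≟_ (suc n) (Ũ n t) ds)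
             ⇔ (Q (Ũ n t) × ∀ j → Q (Ũ (suc n + toℕ j) (proj₂ (lookup ds j))))
    rest = chain-lhs Q (suc n) (Ũ n t) ds
    shift : (Q (Ũ n t) × ∀ j → Q (Ũ (suc n + toℕ j) (proj₂ (lookup ds j))))
              ⇔ (∀ j → Q (Ũ (n + toℕ j) (proj₂ (lookup ((s , t) ∷ ds) j))))
    shift = shift-∀ (λ k j → Q (Ũ k (proj₂ (lookup ((s , t) ∷ ds) j)))) n

  chain-rhs : (Q : Term (F ⊎ ℕ) V → Set) (n : ℕ) (l′ : Term (F ⊎ ℕ) V) (ds : List Cond) →
              All (λ rule → Q (proj₂ rule)) (chain ρ _≟_ n l′ ds)
                ⇔ (Q (lift (rhs ρ)) × ∀ j → Q (Ũ (n + toℕ j) (proj₁ (lookup ds j))))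
  chain-rhs Q n l′ [] = mk⇔ (λ { (q ∷ []) → q , λ () }) (λ (q , _) → q ∷ [])
  chain-rhs Q n l′ ((s , t) ∷ ds) = mk⇔
    (λ { (q ∷ qs) → let (qr , qs′) = to rest qs in qr , to shift (q , qs′) })
    (λ (qr , qs) → let (q , qs′) = from shift qs in q ∷ from rest (qr , qs′))
    where
    rest : All (λ rule → Q (proj₂ rule)) (chain ρ _≟_ (suc n) (Ũ n t) ds)
             ⇔ (Q (lift (rhs ρ)) × ∀ j → Q (Ũ (suc n + toℕ j) (proj₁ (lookup ds j))))
    rest = chain-rhs Q (suc n) (Ũ n t) ds
    shift : (Q (Ũ n s) × ∀ j → Q (Ũ (suc n + toℕ j) (proj₁ (lookup ds j))))
              ⇔ (∀ j → Q (Ũ (n + toℕ j) (proj₁ (lookup ((s , t) ∷ ds) j))))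
    shift = shift-∀ (λ k j → Q (Ũ k (proj₁ (lookup ((s , t) ∷ ds) j)))) n

  RSof : List Cond → List V
  RSof ds = vars (rhs ρ) ++ concatMap (λ c → vars (proj₁ c)) ds

  TailCovered : List Cond → Set
  TailCovered ds = ∀ j → vars (proj₂ (lookup ds j)) ⊆ RSof (drop (suc (toℕ j)) ds)

  rhs-vars : vars (lift (rhs ρ)) ≡ RSof []
  rhs-vars = trans (vars-lift (rhs ρ)) (sym (++-identityʳ (vars (rhs ρ))))

  RSof-rhs : ∀ ds → vars (rhs ρ) ⊆ RSof ds
  RSof-rhs ds = xs⊆xs++ys (vars (rhs ρ)) (concatMap (λ c → vars (proj₁ c)) ds)

  RSof-head : ∀ c ds → vars (proj₁ c) ⊆ RSof (c ∷ ds)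
  RSof-head c ds x∈ = ∈-++⁺ʳ (vars (rhs ρ)) (∈-++⁺ˡ x∈)

  RSof-tail : ∀ c ds → RSof ds ⊆ RSof (c ∷ ds)
  RSof-tail c ds = ++⁺ʳ (vars (rhs ρ)) (xs⊆ys++xs _ (vars (proj₁ c)))

  RSof-cons⁻ : ∀ c ds {x} → x ∈ RSof (c ∷ ds) → x ∈ vars (proj₁ c) ⊎ x ∈ RSof ds
  RSof-cons⁻ c ds x∈ with ∈-++⁻ (vars (rhs ρ)) x∈
  ... | inj₁ x∈r = inj₂ (∈-++⁺ˡ x∈r)
  ... | inj₂ x∈ss with ∈-++⁻ (vars (proj₁ c)) x∈ss
  ...   | inj₁ x∈s = inj₁ x∈s
  ...   | inj₂ x∈ss′ = inj₂ (∈-++⁺ʳ (vars (rhs ρ)) x∈ss′)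

  RSof⊆Y : ∀ n {s t ds} → drop n cs ≡ (s , t) ∷ ds → RSof ds ⊆ Yℕ ρ n
  RSof⊆Y n {t = t} {ds} eq =
    subst (RSof ds ⊆_) (sym (Y-step n eq)) (++⁺ʳ (vars (rhs ρ)) (⊆-trans (svars⊆ ds) (xs⊆ys++xs _ (vars t))))
    where
    svars⊆ : ∀ ds → concatMap (λ c → vars (proj₁ c)) ds ⊆ varsBoth ρ ds
    svars⊆ []             ()
    svars⊆ ((a , b) ∷ ds) = ++⁺ (xs⊆xs++ys (vars a) (vars b)) (svars⊆ ds)

  varsBoth⊆RSof : ∀ ds → TailCovered ds → varsBoth ρ ds ⊆ RSof ds
  varsBoth⊆RSof []             covered ()
  varsBoth⊆RSof ((a , b) ∷ ds) covered =
    from ++-⊆⇔ ( from ++-⊆⇔ (RSof-head (a , b) ds , ⊆-trans (covered fzero) (RSof-tail (a , b) ds))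
               , ⊆-trans (varsBoth⊆RSof ds (λ j → covered (fsuc j))) (RSof-tail (a , b) ds))

  U-⊆⇔ : ∀ i a {B} → (vars (Ũ i a) ⊆ B) ⇔ (vars a ⊆ B × Z i ⊆ B)
  U-⊆⇔ i a {B} = subst (λ xs → (xs ⊆ B) ⇔ (vars a ⊆ B × Z i ⊆ B)) (sym (vars-U i a)) ++-⊆⇔

  NE-sound : ∀ n l′ ds → All NE (chain ρ _≟_ n l′ ds) → vars l′ ⊆ RSof ds × TailCovered ds
  NE-sound n l′ []             (ne ∷ [])  = subst (vars l′ ⊆_) rhs-vars ne , λ ()
  NE-sound n l′ ((s , t) ∷ ds) (ne ∷ nes) = l′⊆ , covered′
    where
    next : vars (Ũ n t) ⊆ RSof ds × TailCovered ds
    next = NE-sound (suc n) (Ũ n t) ds nes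

    next⊆ : vars (Ũ n t) ⊆ RSof ds
    next⊆ = proj₁ next

    covered′ : TailCovered ((s , t) ∷ ds)
    covered′ fzero    = proj₁ (to (U-⊆⇔ n t) next⊆)
    covered′ (fsuc j) = proj₂ next j

    -- Var(l′) ⊆ Var(s) ++ Zₙ, and Zₙ ⊆ Var(Uₙ(t, Z⃗ₙ)) is covered by the next rule
    l′⊆ : vars l′ ⊆ RSof ((s , t) ∷ ds)
    l′⊆ = ⊆-trans (subst (vars l′ ⊆_) (vars-U n s) ne)
                  (from ++-⊆⇔ (RSof-head (s , t) ds , ⊆-trans (proj₂ (to (U-⊆⇔ n t) next⊆)) (RSof-tail (s , t) ds)))

  -- Conversely, the chain from l′ over the conditions ds = drop n cs is
  -- non-erasing as soon as Var(l′) ⊆ Xₙ (always true along the unraveling),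
  -- Var(l′) ⊆ Var(r, s of ds), and ds is TailCovered.
  NE-complete : ∀ n l′ ds → drop n cs ≡ ds → vars l′ ⊆ Xℕ ρ n → vars l′ ⊆ RSof ds →
                TailCovered ds → All NE (chain ρ _≟_ n l′ ds)
  NE-complete n l′ [] _ _ l′⊆RS _ = subst (vars l′ ⊆_) (sym rhs-vars) l′⊆RS ∷ []
  NE-complete n l′ ((s , t) ∷ ds) eq l′⊆X l′⊆RS covered =
    first ∷ NE-complete (suc n) (Ũ n t) ds (drop-suc n cs eq) next⊆X next⊆RS (λ j → covered (fsuc j))
    where
    -- a variable of l′ not in s lies in r or a later s, hence in Yₙ, hence in Zₙ
    first : vars l′ ⊆ vars (Ũ n s)
    first {x} x∈ = subst (x ∈_) (sym (vars-U n s)) (place (RSof-cons⁻ (s , t) ds (l′⊆RS x∈)))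
      where
      place : x ∈ vars s ⊎ x ∈ RSof ds → x ∈ vars s ++ Z n
      place (inj₁ x∈s)  = ∈-++⁺ˡ x∈s
      place (inj₂ x∈RS) = ∈-++⁺ʳ (vars s) (from (∈Z⇔ {n}) (l′⊆X x∈ , RSof⊆Y n eq x∈RS))

    Z⊆X : Z n ⊆ Xℕ ρ n
    Z⊆X x∈ = proj₁ (to (∈Z⇔ {n}) x∈)

    Z⊆Y : Z n ⊆ Yℕ ρ n
    Z⊆Y x∈ = proj₂ (to (∈Z⇔ {n}) x∈)

    next⊆X : vars (Ũ n t) ⊆ Xℕ ρ (suc n)
    next⊆X = subst (vars (Ũ n t) ⊆_) (sym (X-step n eq))
               (from (U-⊆⇔ n t) (xs⊆ys++xs (vars t) _ , ⊆-trans Z⊆X (xs⊆xs++ys _ (vars t))))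

    Y⊆RS : Yℕ ρ n ⊆ RSof ds
    Y⊆RS = subst (_⊆ RSof ds) (sym (Y-step n eq))
             (from ++-⊆⇔ (RSof-rhs ds , from ++-⊆⇔ (covered fzero , varsBoth⊆RSof ds (λ j → covered (fsuc j)))))

    next⊆RS : vars (Ũ n t) ⊆ RSof ds
    next⊆RS = from (U-⊆⇔ n t) (covered fzero , ⊆-trans Z⊆Y Y⊆RS)

  linear-Ut : ∀ i → Linear (Ũ (toℕ i) (t ρ i)) ⇔ (Linear (t ρ i) × Disjoint (vars (t ρ i)) (X ρ i))
  linear-Ut i = (⇔-id _ ×-⇔ disjoint-Z⇔X {toℕ i} _ (t⊆Y i)) ⇔-∘ linear-U (toℕ i) (t ρ i)

  linear-Us : Deterministic ρ →
              ∀ i → Linear (Ũ (toℕ i) (s ρ i)) ⇔ (Linear (s ρ i) × Disjoint (vars (s ρ i)) (Y ρ i))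
  linear-Us det i = (⇔-id _ ×-⇔ disjoint-Z⇔Y {toℕ i} _ (det i)) ⇔-∘ linear-U (toℕ i) (s ρ i)

module _ {F V : Set} (_≟_ : DecidableEquality V) (ρ : CRule F V) where
  open Unraveling _≟_ ρ

  left-linear-part : Uopt-P ρ _≟_ LL
    ⇔ (Linear (lhs ρ) × (∀ i → Linear (t ρ i)) × (∀ i → Disjoint (vars (t ρ i)) (X ρ i)))
  left-linear-part =
    (⇔-id _ ×-⇔ ∀-×-⇔) ⇔-∘ ((linear-lift (lhs ρ) ×-⇔ ∀-⇔ linear-Ut) ⇔-∘ chain-lhs Linear 0 (lift (lhs ρ)) cs)

  right-linear-part : Deterministic ρ → Uopt-P ρ _≟_ RL
    ⇔ (Linear (rhs ρ) × (∀ i → Linear (s ρ i)) × (∀ i → Disjoint (vars (s ρ i)) (Y ρ i)))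
  right-linear-part det =
    (⇔-id _ ×-⇔ ∀-×-⇔) ⇔-∘ ((linear-lift (rhs ρ) ×-⇔ ∀-⇔ (linear-Us det)) ⇔-∘ chain-rhs Linear 0 (lift (lhs ρ)) cs)

  non-erasing-part : Uopt-P ρ _≟_ NE ⇔ ((vars (lhs ρ) ⊆ RSall ρ) × (∀ i → vars (t ρ i) ⊆ RS ρ i))
  non-erasing-part = mk⇔ sound complete
    where
    lift-l : vars (lift (lhs ρ)) ≡ vars (lhs ρ)
    lift-l = vars-lift (lhs ρ)

    sound : Uopt-P ρ _≟_ NE → (vars (lhs ρ) ⊆ RSall ρ) × (∀ i → vars (t ρ i) ⊆ RS ρ i)
    sound ne with NE-sound 0 (lift (lhs ρ)) cs ne
    ... | l⊆ , covered = subst (_⊆ RSall ρ) lift-l l⊆ , covered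

    complete : (vars (lhs ρ) ⊆ RSall ρ) × (∀ i → vars (t ρ i) ⊆ RS ρ i) → Uopt-P ρ _≟_ NE
    complete (l⊆ , covered) =
      NE-complete 0 (lift (lhs ρ)) cs refl
        (subst (_⊆ Xℕ ρ 0) (sym lift-l) (xs⊆xs++ys (vars (lhs ρ)) []))
        (subst (_⊆ RSall ρ) (sym lift-l) l⊆)
        covered

theorem3p8 : {F V : Set} (_≟_ : DecidableEquality V) (ρ : CRule F V) →
    Deterministic ρ →
    (Uopt-P ρ _≟_ LL ⇔ (Linear (lhs ρ) × (∀ i → Linear (t ρ i)) × (∀ i → Disjoint (vars (t ρ i)) (X ρ i))))
    × (Uopt-P ρ _≟_ RL ⇔ (Linear (rhs ρ) × (∀ i → Linear (s ρ i)) × (∀ i → Disjoint (vars (s ρ i)) (Y ρ i))))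
    × (Uopt-P ρ _≟_ NE ⇔ ((vars (lhs ρ) ⊆ RSall ρ) × (∀ i → vars (t ρ i) ⊆ RS ρ i)))
theorem3p8 _≟_ ρ det = left-linear-part _≟_ ρ , right-linear-part _≟_ ρ det , non-erasing-part _≟_ ρ
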